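{- For every $n\ge 3$, the cycle $C_n$ is $Q$-unique: if $H$ is a finite simple graph with $Q(H;x,y)=Q(C_n;x,y)$, then $H\cong C_n$.
   Context: For a finite simple graph $G=(V,E)$, the subgraph component polynomial is $Q(G;x,y)=\sum_{X\subseteq V} x^{|X|}y^{k(G[X])}$, where $G[X]$ is the induced subgraph on $X$ and $k(\cdot)$ denotes the number of connected components. $C_n$ is the cycle on $n$ vertices. -}

module Defs where

open import Data.Nat using (ℕ; zero; suc; _<ᵇ_; _≡ᵇ_; _%_; NonZero; _≤_; _<_; z≤n; s≤s)
open import Data.Nat.Properties using (≡ᵇ⇒≡; <-cmp; ≤-antisym)
open import Data.Nat.DivMod using (m<n⇒m%n≡m; n%n≡0)
open import Data.Fin.Properties using (toℕ<n)
open import Data.Bool.Properties using (∨-comm)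
open import Relation.Binary.PropositionalEquality using (refl; trans; subst) renaming (sym to ≡-sym)
open import Relation.Binary using (tri<; tri≈; tri>)
open import Data.Empty using (⊥; ⊥-elim)
open import Data.Nat.Properties using (<-irrefl)
open import Data.Bool using (Bool; true; false; _∧_; _∨_; not; if_then_else_)
open import Data.Fin using (Fin; toℕ)
open import Data.List using (List; []; _∷_; map; _++_; length; filterᵇ; allFin)
open import Data.Vec using (Vec; []; _∷_; lookup)
open import Relation.Binary.PropositionalEquality using (_≡_)
open import Data.Product using (Σ; _×_)
open import Function.Bundles using (_↔_; Inverse)

record Graph : Set where
  field
    n      : ℕ
    adj    : Fin n → Fin n → Bool
    sym    : ∀ i j → adj i j ≡ adj j i
    irrefl : ∀ i → adj i i ≡ false
open Graph public

anyᵇ : {A : Set} → (A → Bool) → List A → Bool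
anyᵇ p [] = false
anyᵇ p (x ∷ xs) = p x ∨ anyᵇ p xs

allᵇ : {A : Set} → (A → Bool) → List A → Bool
allᵇ p [] = true
allᵇ p (x ∷ xs) = p x ∧ allᵇ p xs

countᵇ : {A : Set} → (A → Bool) → List A → ℕ
countᵇ p xs = length (filterᵇ p xs)

Subset : ℕ → Set
Subset n = Vec Bool n

allSubsets : (n : ℕ) → List (Subset n)
allSubsets zero = [] ∷ []
allSubsets (suc n) = map (true ∷_) (allSubsets n) ++ map (false ∷_) (allSubsets n)

_∈ᵇ_ : {n : ℕ} → Fin n → Subset n → Bool
i ∈ᵇ X = lookup X i

size : {n : ℕ} → Subset n → ℕ
size {n} X = countᵇ (λ i → lookup X i) (allFin n)

-- walk G X k u v : there is a walk of length ≤ k from u to v inside G[X]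
walk : (G : Graph) → Subset (n G) → ℕ → Fin (n G) → Fin (n G) → Bool
walk G X zero u v = (u ∈ᵇ X) ∧ (toℕ u ≡ᵇ toℕ v)
walk G X (suc k) u v =
  walk G X k u v ∨ anyᵇ (λ w → walk G X k u w ∧ adj G w v ∧ (v ∈ᵇ X)) (allFin (n G))

-- u and v lie in the same connected component of G[X]
-- (any walk can be shortened to a path of length < n G)
connected : (G : Graph) → Subset (n G) → Fin (n G) → Fin (n G) → Bool
connected G X u v = walk G X (n G) u v

-- k(G[X]) : number of components, counted as the number of vertices of X
-- that are the smallest vertex of their component
components : (G : Graph) → Subset (n G) → ℕ
components G X = countᵇ (λ v → v ∈ᵇ X ∧
    allᵇ (λ u → not ((toℕ u <ᵇ toℕ v) ∧ connected G X u v)) (allFin (n G)))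
    (allFin (n G))

-- Coefficient of x^i y^j in Q(G;x,y) = Σ_{X ⊆ V} x^|X| y^k(G[X])
Qcoeff : Graph → ℕ → ℕ → ℕ
Qcoeff G i j = countᵇ (λ X → (size X ≡ᵇ i) ∧ (components G X ≡ᵇ j)) (allSubsets (n G))

SameQ : Graph → Graph → Set
SameQ G H = ∀ i j → Qcoeff G i j ≡ Qcoeff H i j

_≅_ : Graph → Graph → Set
G ≅ H = Σ (Fin (n G) ↔ Fin (n H)) λ f →
          ∀ u v → adj H (Inverse.to f u) (Inverse.to f v) ≡ adj G u v

cycAdj : (m : ℕ) → .{{NonZero m}} → Fin m → Fin m → Bool
cycAdj m i j = ((suc (toℕ i) % m) ≡ᵇ toℕ j) ∨ ((suc (toℕ j) % m) ≡ᵇ toℕ i)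

private
  n≢1+n : (k : ℕ) → k ≡ suc k → ⊥
  n≢1+n zero ()
  n≢1+n (suc k) e = n≢1+n k (Data.Nat.Properties.suc-injective e)

  suc%≢ : (m : ℕ) → .{{_ : NonZero m}} → 3 ≤ m → (i : Fin m) → suc (toℕ i) % m ≡ toℕ i → ⊥
  suc%≢ m h i eq with <-cmp (suc (toℕ i)) m
  ... | tri< lt _ _ = n≢1+n (toℕ i) (≡-sym (trans (≡-sym (m<n⇒m%n≡m lt)) eq))
  ... | tri≈ _ e _ with trans (≡-sym (trans (subst (λ k → suc (toℕ i) % m ≡ k % m) e refl) (n%n≡0 m))) eq | e
  ...   | z | e' = go h (subst (λ t → suc t ≡ m) (≡-sym z) e')
    where
      go : ∀ {k} → 3 ≤ k → 1 ≡ k → ⊥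
      go (s≤s (s≤s h)) ()
  suc%≢ m h i eq | tri> _ _ gt = <-irrefl refl (Data.Nat.Properties.≤-trans gt (toℕ<n i))

  cycIrr : (m : ℕ) → .{{_ : NonZero m}} → 3 ≤ m → (i : Fin m) → cycAdj m i i ≡ false
  cycIrr m h i with suc (toℕ i) % m ≡ᵇ toℕ i in eq
  ... | false = refl
  ... | true = ⊥-elim (suc%≢ m h i (≡ᵇ⇒≡ _ _ (subst Data.Bool.T (≡-sym eq) _)))

Cycle : (m : ℕ) → 3 ≤ m → Graph
Cycle m@(suc _) h = record
  { n = m
  ; adj = cycAdj m
  ; sym = λ i j → ∨-comm (suc (toℕ i) % m ≡ᵇ toℕ j) (suc (toℕ j) % m ≡ᵇ toℕ i)
  ; irrefl = cycIrr m h
  }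

module Submission where

-- Four features of a graph can be read off from Q:
--   * its order n, the top degree in x (order-determined);
--   * twice its number of edges, i.e. its degree sum, from the coefficient
--     of x² y (Qcoeff-edges, handshake);
--   * whether every k-vertex set induces a connected subgraph: this holds
--     iff the coefficient of x^k y counts all k-subsets (AllConnected).
-- For C_m the vertex set and every vertex-deleted subset are connected and
-- the degree sum is 2m.  So H has m vertices, is connected, has every
-- vertex-deleted subgraph connected — forcing minimum degree ≥ 2 — and has
-- degree sum 2m, so it is 2-regular.  A connected 2-regular graph on m
-- vertices is C_m (CycleRecognition): following edges from a vertex traces
-- a closed trail through all m vertices.

open import Data.Nat using (ℕ; zero; suc; _+_; _*_; _∸_; _≤_; _<_; z≤n; s≤s; s≤s⁻¹; _≡ᵇ_; _<ᵇ_; _%_; _≤?_)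
open import Data.Nat.Properties hiding (_≟_)
open import Data.Nat.DivMod using (_mod_; m<n⇒m%n≡m; n%n≡0)
open import Data.Nat.Tactic.RingSolver using (solve-∀)
open import Algebra.Properties.CommutativeSemigroup +-commutativeSemigroup using (interchange)
open import Data.Bool using (Bool; true; false; _∧_; _∨_; not; T)
open import Data.Bool.Properties using (∧-zeroʳ; ∧-identityʳ; ∨-identityʳ)
open import Data.Fin using (Fin; zero; suc; toℕ; fromℕ<; fromℕ; inject₁; _≟_)
open import Data.Fin.Properties using (toℕ-injective; toℕ<n; toℕ-fromℕ<; toℕ-fromℕ; toℕ-inject₁; injective⇒≤; pigeonhole)
open import Data.List using ([]; _∷_; map; _++_; allFin; tabulate)
open import Data.List.Membership.Propositional using (_∈_)
open import Data.List.Membership.Propositional.Properties using (∈-++⁺ˡ; ∈-++⁺ʳ; ∈-map⁺)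
open import Data.List.Relation.Unary.Any using (here; there)
open import Data.Vec using ([]; _∷_; lookup) renaming (tabulate to tabulateⱽ)
open import Data.Vec.Properties using (lookup∘tabulate)
open import Data.Product using (Σ; _×_; _,_; proj₁; proj₂)
open import Data.Sum using (_⊎_; inj₁; inj₂)
open import Data.Unit using (tt)
open import Data.Empty using (⊥; ⊥-elim)
open import Function using (_∘_; id)
open import Function.Bundles using (mk↔ₛ′)
open import Relation.Nullary using (yes; no)
open import Relation.Binary using (tri<; tri≈; tri>)
open import Relation.Binary.PropositionalEquality
open import Defs renaming (sym to adj-sym)

∧-elimˡ : ∀ {a b} → a ∧ b ≡ true → a ≡ true
∧-elimˡ {true} _ = refl

∧-elimʳ : ∀ {a b} → a ∧ b ≡ true → b ≡ true
∧-elimʳ {true} e = e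

∨-elim : ∀ {a b} → a ∨ b ≡ true → a ≡ true ⊎ b ≡ true
∨-elim {true} _ = inj₁ refl
∨-elim {false} e = inj₂ e

∨-introˡ : ∀ {a} b → a ≡ true → a ∨ b ≡ true
∨-introˡ b refl = refl

∨-introʳ : ∀ a {b} → b ≡ true → a ∨ b ≡ true
∨-introʳ true e = refl
∨-introʳ false e = e

not-elim : ∀ {b} → not b ≡ true → b ≡ false
not-elim {false} _ = refl

bool-ext : ∀ {a b : Bool} → (a ≡ true → b ≡ true) → (b ≡ true → a ≡ true) → a ≡ b
bool-ext {true} f g = sym (f refl)
bool-ext {false} {true} f g = g refl
bool-ext {false} {false} f g = refl

∨-absorbʳ : ∀ a r → (r ≡ true → a ≡ true) → a ∨ r ≡ a
∨-absorbʳ true r h = refl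
∨-absorbʳ false true h = sym (h refl)
∨-absorbʳ false false h = refl

≡ᵇ-elim : ∀ {a b} → (a ≡ᵇ b) ≡ true → a ≡ b
≡ᵇ-elim {a} {b} e = ≡ᵇ⇒≡ a b (subst T (sym e) tt)

≡ᵇ-intro : ∀ {a b} → a ≡ b → (a ≡ᵇ b) ≡ true
≡ᵇ-intro {a} refl with a ≡ᵇ a | ≡⇒≡ᵇ a a refl
... | true | _ = refl

<ᵇ-intro : ∀ {a b} → a < b → (a <ᵇ b) ≡ true
<ᵇ-intro {a} {b} lt with a <ᵇ b | <⇒<ᵇ lt
... | true | _ = refl

_==_ : ∀ {n} → Fin n → Fin n → Bool
a == b = toℕ a ≡ᵇ toℕ b

==-elim : ∀ {n} {a b : Fin n} → (a == b) ≡ true → a ≡ b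
==-elim e = toℕ-injective (≡ᵇ-elim e)

==-refl : ∀ {n} (a : Fin n) → (a == a) ≡ true
==-refl a = ≡ᵇ-intro {toℕ a} refl

==-≢ : ∀ {n} {a b : Fin n} → a ≢ b → (a == b) ≡ false
==-≢ {a = a} {b} ne with a == b in e
... | true = ⊥-elim (ne (==-elim e))
... | false = refl

==-false⇒≢ : ∀ {n} {a b : Fin n} → (a == b) ≡ false → a ≢ b
==-false⇒≢ {a = a} e refl with trans (sym e) (==-refl a)
... | ()

∧-not== : ∀ {n} (b : Bool) {x a : Fin n} → b ≡ true → x ≢ a → b ∧ not (x == a) ≡ true
∧-not== b {x} {a} e ne rewrite e | ==-≢ ne = refl

b2n : Bool → ℕ
b2n true = 1
b2n false = 0

count : (n : ℕ) → (Fin n → Bool) → ℕ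
count zero p = 0
count (suc n) p = b2n (p zero) + count n (p ∘ suc)

anyᶠ : (n : ℕ) → (Fin n → Bool) → Bool
anyᶠ zero p = false
anyᶠ (suc n) p = p zero ∨ anyᶠ n (p ∘ suc)

allᶠ : (n : ℕ) → (Fin n → Bool) → Bool
allᶠ zero p = true
allᶠ (suc n) p = p zero ∧ allᶠ n (p ∘ suc)

sumᶠ : (n : ℕ) → (Fin n → ℕ) → ℕ
sumᶠ zero f = 0
sumᶠ (suc n) f = f zero + sumᶠ n (f ∘ suc)

countᵇ-tabulate : ∀ {A : Set} n (p : A → Bool) (f : Fin n → A) →
  countᵇ p (tabulate f) ≡ count n (p ∘ f)
countᵇ-tabulate zero p f = refl
countᵇ-tabulate (suc n) p f with p (f zero)
... | true = cong suc (countᵇ-tabulate n p (f ∘ suc))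
... | false = countᵇ-tabulate n p (f ∘ suc)

anyᵇ-tabulate : ∀ {A : Set} n (p : A → Bool) (f : Fin n → A) →
  anyᵇ p (tabulate f) ≡ anyᶠ n (p ∘ f)
anyᵇ-tabulate zero p f = refl
anyᵇ-tabulate (suc n) p f = cong (p (f zero) ∨_) (anyᵇ-tabulate n p (f ∘ suc))

allᵇ-tabulate : ∀ {A : Set} n (p : A → Bool) (f : Fin n → A) →
  allᵇ p (tabulate f) ≡ allᶠ n (p ∘ f)
allᵇ-tabulate zero p f = refl
allᵇ-tabulate (suc n) p f = cong (p (f zero) ∧_) (allᵇ-tabulate n p (f ∘ suc))

count-ext : ∀ n (p q : Fin n → Bool) → (∀ i → p i ≡ q i) → count n p ≡ count n q
count-ext zero p q h = refl
count-ext (suc n) p q h = cong₂ _+_ (cong b2n (h zero)) (count-ext n _ _ (h ∘ suc))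

count-none : ∀ n (p : Fin n → Bool) → (∀ i → p i ≡ false) → count n p ≡ 0
count-none zero p h = refl
count-none (suc n) p h rewrite h zero = count-none n _ (h ∘ suc)

count-all : ∀ n (p : Fin n → Bool) → (∀ i → p i ≡ true) → count n p ≡ n
count-all zero p h = refl
count-all (suc n) p h rewrite h zero = cong suc (count-all n _ (h ∘ suc))

count-≤ : ∀ n (p : Fin n → Bool) → count n p ≤ n
count-≤ zero p = z≤n
count-≤ (suc n) p with p zero
... | true = s≤s (count-≤ n _)
... | false = m≤n⇒m≤1+n (count-≤ n _)

count-witness : ∀ n (p : Fin n → Bool) → 1 ≤ count n p → Σ (Fin n) λ a → p a ≡ true
count-witness (suc n) p h with p zero in e
... | true = zero , e
... | false with count-witness n _ h
...   | a , pa = suc a , pa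

count-remove : ∀ n (p : Fin n → Bool) (a : Fin n) → p a ≡ true →
  count n p ≡ suc (count n (λ z → p z ∧ not (z == a)))
count-remove (suc n) p zero pa rewrite pa =
  cong suc (count-ext n _ _ (λ i → sym (∧-identityʳ (p (suc i)))))
count-remove (suc n) p (suc a) pa with p zero
... | true = cong suc (count-remove n _ a pa)
... | false = count-remove n _ a pa

count≥1 : ∀ n (p : Fin n → Bool) (a : Fin n) → p a ≡ true → 1 ≤ count n p
count≥1 n p a pa rewrite count-remove n p a pa = s≤s z≤n

count≥2 : ∀ n (p : Fin n → Bool) (a b : Fin n) → p a ≡ true → p b ≡ true → a ≢ b →
  2 ≤ count n p
count≥2 n p a b pa pb ne rewrite count-remove n p a pa =
  s≤s (count≥1 n _ b (∧-not== (p b) pb (ne ∘ sym)))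

count≥3 : ∀ n (p : Fin n → Bool) (a b c : Fin n) → p a ≡ true → p b ≡ true → p c ≡ true →
  a ≢ b → a ≢ c → b ≢ c → 3 ≤ count n p
count≥3 n p a b c pa pb pc ab ac bc rewrite count-remove n p a pa =
  s≤s (count≥2 n _ b c (∧-not== (p b) pb (ab ∘ sym)) (∧-not== (p c) pc (ac ∘ sym)) bc)

count-zero : ∀ n (p : Fin n → Bool) → count n p ≡ 0 → ∀ i → p i ≡ false
count-zero n p e i with p i in pi
... | false = refl
... | true with subst (1 ≤_) e (count≥1 n p i pi)
...   | ()

count-unique : ∀ n (p : Fin n → Bool) (a : Fin n) → p a ≡ true → (∀ z → z ≢ a → p z ≡ false) →
  count n p ≡ 1
count-unique n p a pa h rewrite count-remove n p a pa = cong suc (count-none n _ rest)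
  where
    rest : ∀ z → p z ∧ not (z == a) ≡ false
    rest z with z == a in e
    ... | true = ∧-zeroʳ (p z)
    ... | false = cong (_∧ true) (h z (==-false⇒≢ e))

count≡1-elim : ∀ n (p : Fin n → Bool) → count n p ≡ 1 →
  Σ (Fin n) λ a → p a ≡ true × (∀ z → p z ≡ true → z ≡ a)
count≡1-elim n p e with count-witness n p (≤-reflexive (sym e))
... | a , pa = a , pa , only
  where
    only : ∀ z → p z ≡ true → z ≡ a
    only z pz with z ≟ a
    ... | yes z≡a = z≡a
    ... | no z≢a with subst (2 ≤_) e (count≥2 n p z a pz pa z≢a)
    ...   | s≤s ()

count-pair : ∀ n (p : Fin n → Bool) (a b : Fin n) → p a ≡ true → p b ≡ true → a ≢ b →
  (∀ c → p c ≡ true → c ≡ a ⊎ c ≡ b) → count n p ≡ 2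
count-pair n p a b pa pb a≢b only = trans (count-remove n p a pa)
  (cong suc (count-unique n (λ z → p z ∧ not (z == a)) b (∧-not== (p b) pb (a≢b ∘ sym)) others))
  where
    others : ∀ z → z ≢ b → p z ∧ not (z == a) ≡ false
    others z z≢b with p z in pz
    ... | false = refl
    ... | true with only z pz
    ...   | inj₁ refl = cong not (==-refl z)
    ...   | inj₂ z≡b = ⊥-elim (z≢b z≡b)

count-complement : ∀ n (p : Fin n → Bool) → count n p + count n (not ∘ p) ≡ n
count-complement zero p = refl
count-complement (suc n) p with p zero
... | true = cong suc (count-complement n _)
... | false = trans (+-suc (count n _) _) (cong suc (count-complement n _))

least-witness : ∀ n (p : Fin n → Bool) (a : Fin n) → p a ≡ true →
  Σ (Fin n) λ r → p r ≡ true × (∀ u → toℕ u < toℕ r → p u ≡ false)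
least-witness (suc n) p a pa with p zero in e
... | true = zero , e , λ u ()
least-witness (suc n) p zero pa | false with trans (sym e) pa
... | ()
least-witness (suc n) p (suc a) pa | false with least-witness n (p ∘ suc) a pa
... | r , pr , h = suc r , pr , below
  where below : ∀ u → toℕ u < toℕ (suc r) → p u ≡ false
        below zero _ = e
        below (suc u) (s≤s lt) = h u lt

two-witnesses : ∀ n (p : Fin n → Bool) → count n p ≡ 2 →
  Σ (Fin n) λ a → Σ (Fin n) λ b →
    a ≢ b × p a ≡ true × p b ≡ true × (∀ c → p c ≡ true → c ≡ a ⊎ c ≡ b)
two-witnesses n p e with count-witness n p (subst (1 ≤_) (sym e) (s≤s z≤n))
... | a , pa with count-witness n (λ z → p z ∧ not (z == a))
                    (subst (1 ≤_) (suc-injective (trans (sym e) (count-remove n p a pa))) (s≤s z≤n))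
...   | b , pb = a , b , a≢b , pa , ∧-elimˡ pb , only
  where
    a≢b : a ≢ b
    a≢b = ==-false⇒≢ (not-elim (∧-elimʳ {p b} pb)) ∘ sym
    only : ∀ c → p c ≡ true → c ≡ a ⊎ c ≡ b
    only c pc with c ≟ a | c ≟ b
    ... | yes c≡a | _ = inj₁ c≡a
    ... | no _ | yes c≡b = inj₂ c≡b
    ... | no c≢a | no c≢b
      with subst (3 ≤_) e (count≥3 n p a b c pa (∧-elimˡ pb) pc a≢b (c≢a ∘ sym) (c≢b ∘ sym))
    ...   | s≤s (s≤s ())

anyᶠ-intro : ∀ n (p : Fin n → Bool) x → p x ≡ true → anyᶠ n p ≡ true
anyᶠ-intro (suc n) p zero e rewrite e = refl
anyᶠ-intro (suc n) p (suc x) e = ∨-introʳ (p zero) (anyᶠ-intro n _ x e)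

anyᶠ-elim : ∀ n (p : Fin n → Bool) → anyᶠ n p ≡ true → Σ (Fin n) λ x → p x ≡ true
anyᶠ-elim (suc n) p e with p zero in px
... | true = zero , px
... | false with anyᶠ-elim n _ e
...   | x , q = suc x , q

anyᶠ-none : ∀ n (p : Fin n → Bool) → (∀ i → p i ≡ false) → anyᶠ n p ≡ false
anyᶠ-none zero p h = refl
anyᶠ-none (suc n) p h rewrite h zero = anyᶠ-none n _ (h ∘ suc)

allᶠ-intro : ∀ n (p : Fin n → Bool) → (∀ x → p x ≡ true) → allᶠ n p ≡ true
allᶠ-intro zero p h = refl
allᶠ-intro (suc n) p h rewrite h zero = allᶠ-intro n _ (h ∘ suc)

allᶠ-elim : ∀ n (p : Fin n → Bool) → allᶠ n p ≡ true → ∀ x → p x ≡ true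
allᶠ-elim (suc n) p e zero = ∧-elimˡ e
allᶠ-elim (suc n) p e (suc x) = allᶠ-elim n _ (∧-elimʳ {p zero} e) x

anyᵇ-allFin-intro : ∀ n (p : Fin n → Bool) x → p x ≡ true → anyᵇ p (allFin n) ≡ true
anyᵇ-allFin-intro n p x e = trans (anyᵇ-tabulate n p id) (anyᶠ-intro n p x e)

anyᵇ-allFin-elim : ∀ n (p : Fin n → Bool) → anyᵇ p (allFin n) ≡ true → Σ (Fin n) λ x → p x ≡ true
anyᵇ-allFin-elim n p e = anyᶠ-elim n p (trans (sym (anyᵇ-tabulate n p id)) e)

allᵇ-allFin-intro : ∀ n (p : Fin n → Bool) → (∀ x → p x ≡ true) → allᵇ p (allFin n) ≡ true
allᵇ-allFin-intro n p h = trans (allᵇ-tabulate n p id) (allᶠ-intro n p h)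

allᵇ-allFin-elim : ∀ n (p : Fin n → Bool) → allᵇ p (allFin n) ≡ true → ∀ x → p x ≡ true
allᵇ-allFin-elim n p e = allᶠ-elim n p (trans (sym (allᵇ-tabulate n p id)) e)

countᵇ-++ : ∀ {A : Set} (p : A → Bool) xs ys → countᵇ p (xs ++ ys) ≡ countᵇ p xs + countᵇ p ys
countᵇ-++ p [] ys = refl
countᵇ-++ p (x ∷ xs) ys with p x
... | true = cong suc (countᵇ-++ p xs ys)
... | false = countᵇ-++ p xs ys

countᵇ-map : ∀ {A B : Set} (p : B → Bool) (f : A → B) xs → countᵇ p (map f xs) ≡ countᵇ (p ∘ f) xs
countᵇ-map p f [] = refl
countᵇ-map p f (x ∷ xs) with p (f x)
... | true = cong suc (countᵇ-map p f xs)
... | false = countᵇ-map p f xs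

countᵇ-ext : ∀ {A : Set} (p q : A → Bool) xs → (∀ x → p x ≡ q x) → countᵇ p xs ≡ countᵇ q xs
countᵇ-ext p q [] h = refl
countᵇ-ext p q (x ∷ xs) h with p x | q x | h x
... | true | true | _ = cong suc (countᵇ-ext p q xs h)
... | false | false | _ = countᵇ-ext p q xs h

countᵇ-none : ∀ {A : Set} (p : A → Bool) xs → (∀ x → p x ≡ false) → countᵇ p xs ≡ 0
countᵇ-none p [] h = refl
countᵇ-none p (x ∷ xs) h rewrite h x = countᵇ-none p xs h

countᵇ-witness : ∀ {A : Set} (p : A → Bool) xs → 1 ≤ countᵇ p xs → Σ A λ x → p x ≡ true
countᵇ-witness p (x ∷ xs) h with p x in e
... | true = x , e
... | false = countᵇ-witness p xs h

countᵇ≥1 : ∀ {A : Set} (p : A → Bool) xs x → x ∈ xs → p x ≡ true → 1 ≤ countᵇ p xs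
countᵇ≥1 p (y ∷ xs) x (here refl) px rewrite px = s≤s z≤n
countᵇ≥1 p (y ∷ xs) x (there mem) px with p y
... | true = s≤s z≤n
... | false = countᵇ≥1 p xs x mem px

countᵇ-∧-≤ : ∀ {A : Set} (p q : A → Bool) xs → countᵇ (λ x → p x ∧ q x) xs ≤ countᵇ p xs
countᵇ-∧-≤ p q [] = z≤n
countᵇ-∧-≤ p q (x ∷ xs) with p x | q x
... | true | true = s≤s (countᵇ-∧-≤ p q xs)
... | true | false = m≤n⇒m≤1+n (countᵇ-∧-≤ p q xs)
... | false | _ = countᵇ-∧-≤ p q xs

countᵇ-∧-≡ : ∀ {A : Set} (p q : A → Bool) xs → countᵇ (λ x → p x ∧ q x) xs ≡ countᵇ p xs →
  ∀ x → x ∈ xs → p x ≡ true → q x ≡ true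
countᵇ-∧-≡ p q (y ∷ xs) e x (here refl) px rewrite px with q x
... | true = refl
... | false = ⊥-elim (<-irrefl e (s≤s (countᵇ-∧-≤ p q xs)))
countᵇ-∧-≡ p q (y ∷ xs) e x (there m) px with p y | q y
... | true | true = countᵇ-∧-≡ p q xs (suc-injective e) x m px
... | true | false = ⊥-elim (<-irrefl e (s≤s (countᵇ-∧-≤ p q xs)))
... | false | _ = countᵇ-∧-≡ p q xs e x m px

-- Walks inside an induced subgraph G[X].

module Walks (G : Graph) (X : Subset (n G)) where
  private
    N : ℕ
    N = n G
    A : Fin N → Fin N → Bool
    A = adj G
    _∈X : Fin N → Set
    v ∈X = lookup X v ≡ true

  walk-start : ∀ k u v → walk G X k u v ≡ true → u ∈X
  walk-start zero u v e = ∧-elimˡ e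
  walk-start (suc k) u v e with ∨-elim {walk G X k u v} e
  ... | inj₁ e' = walk-start k u v e'
  ... | inj₂ e' with anyᵇ-allFin-elim N _ e'
  ...   | w , ew = walk-start k u w (∧-elimˡ ew)

  walk-end : ∀ k u v → walk G X k u v ≡ true → v ∈X
  walk-end zero u v e with ==-elim {a = u} {v} (∧-elimʳ {lookup X u} e)
  ... | refl = ∧-elimˡ e
  walk-end (suc k) u v e with ∨-elim {walk G X k u v} e
  ... | inj₁ e' = walk-end k u v e'
  ... | inj₂ e' with anyᵇ-allFin-elim N _ e'
  ...   | w , ew = ∧-elimʳ {A w v} (∧-elimʳ {walk G X k u w} ew)

  walk-refl : ∀ k u → u ∈X → walk G X k u u ≡ true
  walk-refl zero u e rewrite e = ==-refl u
  walk-refl (suc k) u e rewrite walk-refl k u e = refl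

  walk-mono : ∀ k k' u v → k ≤ k' → walk G X k u v ≡ true → walk G X k' u v ≡ true
  walk-mono k k' u v k≤k' e = subst (λ j → walk G X j u v ≡ true) (m∸n+n≡m k≤k') (extend (k' ∸ k))
    where
      extend : ∀ d → walk G X (d + k) u v ≡ true
      extend zero = e
      extend (suc d) = ∨-introˡ _ (extend d)

  walk-step : ∀ k u w v → walk G X k u w ≡ true → A w v ≡ true → v ∈X →
    walk G X (suc k) u v ≡ true
  walk-step k u w v e a x = ∨-introʳ (walk G X k u v) (anyᵇ-allFin-intro N _ w edge)
    where
      edge : walk G X k u w ∧ A w v ∧ lookup X v ≡ true
      edge rewrite e | a | x = refl

  walk⇒connected : ∀ k u v → k ≤ N → walk G X k u v ≡ true → connected G X u v ≡ true
  walk⇒connected k u v k≤N = walk-mono k N u v k≤N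

  path-walk : (p : ℕ → Fin N) (L : ℕ) → (∀ k → k ≤ L → p k ∈X) →
    (∀ k → k < L → A (p k) (p (suc k)) ≡ true) → ∀ k → k ≤ L → walk G X k (p 0) (p k) ≡ true
  path-walk p L inX step zero le = walk-refl 0 (p 0) (inX 0 z≤n)
  path-walk p L inX step (suc k) le =
    walk-step k (p 0) (p k) (p (suc k)) (path-walk p L inX step k (<⇒≤ le)) (step k le) (inX (suc k) le)

  Closed : (Fin N → Bool) → Set
  Closed P = ∀ x y → x ∈X → y ∈X → A x y ≡ true → P x ≡ true → P y ≡ true

  walk-closed : (P : Fin N → Bool) → Closed P → ∀ k u v → walk G X k u v ≡ true →
    P u ≡ true → P v ≡ true
  walk-closed P cl zero u v e pu with ==-elim {a = u} {v} (∧-elimʳ {lookup X u} e)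
  ... | refl = pu
  walk-closed P cl (suc k) u v e pu with ∨-elim {walk G X k u v} e
  ... | inj₁ e' = walk-closed P cl k u v e' pu
  ... | inj₂ e' with anyᵇ-allFin-elim N _ e'
  ...   | w , ew = cl w v (walk-end k u w wk) (∧-elimʳ {A w v} rest) (∧-elimˡ rest)
                        (walk-closed P cl k u w wk pu)
    where
      wk : walk G X k u w ≡ true
      wk = ∧-elimˡ ew
      rest : A w v ∧ lookup X v ≡ true
      rest = ∧-elimʳ {walk G X k u w} ew

  isLeader : Fin N → Bool
  isLeader v = lookup X v ∧ allᵇ (λ u → not ((toℕ u <ᵇ toℕ v) ∧ connected G X u v)) (allFin N)

  components≡count : components G X ≡ count N isLeader
  components≡count = countᵇ-tabulate N isLeader id

  leader-intro : ∀ r → r ∈X → (∀ u → toℕ u < toℕ r → connected G X u r ≡ true → ⊥) →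
    isLeader r ≡ true
  leader-intro r xr h rewrite xr = allᵇ-allFin-intro N _ noSmaller
    where
      noSmaller : ∀ u → not ((toℕ u <ᵇ toℕ r) ∧ connected G X u r) ≡ true
      noSmaller u with toℕ u <ᵇ toℕ r in e1 | connected G X u r in e2
      ... | false | _ = refl
      ... | true | false = refl
      ... | true | true = ⊥-elim (h u (<ᵇ⇒< (toℕ u) (toℕ r) (subst T (sym e1) tt)) e2)

  leader-elim : ∀ v → isLeader v ≡ true → ∀ u → toℕ u < toℕ v → connected G X u v ≡ true → ⊥
  leader-elim v e u lt c with allᵇ-allFin-elim N _ (∧-elimʳ {lookup X v} e) u
  ... | r rewrite <ᵇ-intro lt | c with r
  ...   | ()

  -- By symmetry of adjacency, the complement of a closed predicate is closed.
  complement-closed : ∀ P → Closed P → Closed (not ∘ P)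
  complement-closed P cl x y xx xy axy npx with P y in py
  ... | false = refl
  ... | true with trans (sym (cl y x xy xx (trans (adj-sym G y x) axy) py)) (not-elim npx)
  ...   | ()

  -- The least element r of X ∩ Q, for Q closed, is a leader: a smaller
  -- vertex connected to r would lie in X ∩ Q as well.
  least-of-closed-is-leader : ∀ Q → Closed Q → ∀ r → r ∈X → Q r ≡ true →
    (∀ u → toℕ u < toℕ r → lookup X u ∧ Q u ≡ false) → isLeader r ≡ true
  least-of-closed-is-leader Q cl r xr qr below = leader-intro r xr no-smaller
    where
      no-smaller : ∀ u → toℕ u < toℕ r → connected G X u r ≡ true → ⊥
      no-smaller u lt c with Q u in qu
      ... | true with trans (sym (below u lt)) (subst (λ z → z ∧ Q u ≡ true) (sym (walk-start N u r c)) qu)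
      ...   | ()
      no-smaller u lt c | false
        with trans (sym (cong not qr)) (walk-closed (not ∘ Q) (complement-closed Q cl) N u r c (cong not qu))
      ...   | ()

  -- If a closed P holds at some vertex of X and fails at another, then G[X]
  -- has at least two components: the least elements of X ∩ P and of X ∖ P
  -- are distinct leaders.
  two-components : (P : Fin N → Bool) → Closed P →
    ∀ a b → a ∈X → P a ≡ true → b ∈X → P b ≡ false → 2 ≤ components G X
  two-components P cl a b xa pa xb pb
    with least-witness N (λ x → lookup X x ∧ P x) a (in-class xa pa)
       | least-witness N (λ x → lookup X x ∧ not (P x)) b (in-class xb (cong not pb))
    where
      in-class : ∀ {x c} → x ∈X → c ≡ true → lookup X x ∧ c ≡ true
      in-class xx e rewrite xx | e = refl
  ... | ra , pra , below-ra | rb , prb , below-rb =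
      subst (2 ≤_) (sym components≡count) (count≥2 N isLeader ra rb
        (least-of-closed-is-leader P cl ra (∧-elimˡ pra) (∧-elimʳ {lookup X ra} pra) below-ra)
        (least-of-closed-is-leader (not ∘ P) (complement-closed P cl) rb (∧-elimˡ prb)
                                   (∧-elimʳ {lookup X rb} prb) below-rb)
        ra≢rb)
    where
      ra≢rb : ra ≢ rb
      ra≢rb refl with trans (sym (∧-elimʳ {lookup X ra} pra)) (not-elim (∧-elimʳ {lookup X ra} prb))
      ... | ()

  one-component : ∀ r → r ∈X → (∀ u → u ∈X → toℕ r ≤ toℕ u) →
    (∀ u → u ∈X → u ≢ r → connected G X r u ≡ true) → components G X ≡ 1
  one-component r xr least reach =
    trans components≡count (count-unique N isLeader r rLeader onlyLeader)
    where
      rLeader : isLeader r ≡ true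
      rLeader = leader-intro r xr (λ u lt c → <⇒≱ lt (least u (walk-start N u r c)))
      onlyLeader : ∀ z → z ≢ r → isLeader z ≡ false
      onlyLeader z z≢r with isLeader z in e
      ... | false = refl
      ... | true = ⊥-elim (leader-elim z e r r<z (reach z (∧-elimˡ e) z≢r))
        where
          r<z : toℕ r < toℕ z
          r<z with <-cmp (toℕ r) (toℕ z)
          ... | tri< lt _ _ = lt
          ... | tri≈ _ eq _ = ⊥-elim (z≢r (sym (toℕ-injective eq)))
          ... | tri> _ _ gt = ⊥-elim (<⇒≱ gt (least z (∧-elimˡ e)))

size≡count : ∀ {n} (X : Subset n) → size X ≡ count n (lookup X)
size≡count {n} X = countᵇ-tabulate n (lookup X) id

size-≤ : ∀ {n} (X : Subset n) → size X ≤ n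
size-≤ {n} X = subst (_≤ n) (sym (size≡count X)) (count-≤ n (lookup X))

allSubsets-complete : ∀ n (X : Subset n) → X ∈ allSubsets n
allSubsets-complete zero [] = here refl
allSubsets-complete (suc n) (true ∷ X) = ∈-++⁺ˡ (∈-map⁺ (true ∷_) (allSubsets-complete n X))
allSubsets-complete (suc n) (false ∷ X) =
  ∈-++⁺ʳ (map (true ∷_) (allSubsets n)) (∈-map⁺ (false ∷_) (allSubsets-complete n X))

countᵇ-allSubsets-suc : ∀ n (φ : Subset (suc n) → Bool) →
  countᵇ φ (allSubsets (suc n)) ≡
    countᵇ (φ ∘ (true ∷_)) (allSubsets n) + countᵇ (φ ∘ (false ∷_)) (allSubsets n)
countᵇ-allSubsets-suc n φ =
  trans (countᵇ-++ φ (map (true ∷_) (allSubsets n)) _)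
        (cong₂ _+_ (countᵇ-map φ (true ∷_) (allSubsets n)) (countᵇ-map φ (false ∷_) (allSubsets n)))

full : ∀ n → Subset n
full zero = []
full (suc n) = true ∷ full n

lookup-full : ∀ n (i : Fin n) → lookup (full n) i ≡ true
lookup-full (suc n) zero = refl
lookup-full (suc n) (suc i) = lookup-full n i

size-full : ∀ n → size (full n) ≡ n
size-full n = trans (size≡count (full n)) (count-all n _ (lookup-full n))

size-n⇒full : ∀ {n} (X : Subset n) → size X ≡ n → ∀ i → lookup X i ≡ true
size-n⇒full {n} X e i with lookup X i in xi
... | true = refl
... | false = ⊥-elim (<-irrefl refl (begin-strict
      n                                        ≡⟨ sym e ⟩
      size X                                   ≡⟨ size≡count X ⟩
      count n (lookup X)                       <⟨ m<m+n _ (count≥1 n (not ∘ lookup X) i (cong not xi)) ⟩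
      count n (lookup X) + count n (not ∘ lookup X) ≡⟨ count-complement n (lookup X) ⟩
      n                                        ∎))
  where open ≤-Reasoning

size-pred⇒one-missing : ∀ n (X : Subset (suc n)) → size X ≡ n →
  Σ (Fin (suc n)) λ v → lookup X v ≡ false × (∀ w → lookup X w ≡ false → w ≡ v)
size-pred⇒one-missing n X e with count≡1-elim (suc n) (not ∘ lookup X) missing≡1
  where
    open ≡-Reasoning
    missing≡1 : count (suc n) (not ∘ lookup X) ≡ 1
    missing≡1 = +-cancelˡ-≡ n _ _ (begin
      n + count (suc n) (not ∘ lookup X)
        ≡⟨ cong (_+ count (suc n) (not ∘ lookup X)) (trans (sym e) (size≡count X)) ⟩
      count (suc n) (lookup X) + count (suc n) (not ∘ lookup X)
        ≡⟨ count-complement (suc n) (lookup X) ⟩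
      suc n
        ≡⟨ +-comm 1 n ⟩
      n + 1 ∎)
... | v , v-missing , only-v = v , not-elim v-missing , λ w xw → only-v w (cong not xw)

Qcoeff-pos : ∀ G (X : Subset (n G)) → 1 ≤ Qcoeff G (size X) (components G X)
Qcoeff-pos G X = countᵇ≥1 _ (allSubsets (n G)) X (allSubsets-complete (n G) X) own-monomial
  where
    own-monomial : (size X ≡ᵇ size X) ∧ (components G X ≡ᵇ components G X) ≡ true
    own-monomial rewrite ≡ᵇ-intro {size X} refl | ≡ᵇ-intro {components G X} refl = refl

Qcoeff-witness : ∀ G i j → 1 ≤ Qcoeff G i j →
  Σ (Subset (n G)) λ X → size X ≡ i × components G X ≡ j
Qcoeff-witness G i j pos with countᵇ-witness _ (allSubsets (n G)) pos
... | X , e = X , ≡ᵇ-elim (∧-elimˡ e) , ≡ᵇ-elim (∧-elimʳ {size X ≡ᵇ i} e)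

-- Q determines the number of vertices: the top degree in x is n.
order-determined : ∀ {G H} → SameQ G H → n G ≡ n H
order-determined {G} {H} same = ≤-antisym (bounded G H same) (bounded H G (λ i j → sym (same i j)))
  where
    bounded : ∀ G H → SameQ G H → n G ≤ n H
    bounded G H same with Qcoeff-witness H (n G) c
        (subst (1 ≤_) (trans (cong (λ s → Qcoeff G s c) (size-full (n G))) (same (n G) c))
               (Qcoeff-pos G (full (n G))))
      where c = components G (full (n G))
    ... | X , size-X , _ = subst (_≤ n H) size-X (size-≤ X)

AllConnected : Graph → ℕ → Set
AllConnected G k = ∀ X → size X ≡ k → components G X ≡ 1

subsetsOfSize : ℕ → ℕ → ℕ
subsetsOfSize n k = countᵇ (λ X → size X ≡ᵇ k) (allSubsets n)

-- G is AllConnected at k exactly when the coefficient of x^k y in Q(G)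
-- is as large as possible, namely the number of k-subsets.
allConnected⇒Qcoeff : ∀ G k → AllConnected G k → Qcoeff G k 1 ≡ subsetsOfSize (n G) k
allConnected⇒Qcoeff G k conn = countᵇ-ext _ _ (allSubsets (n G)) pointwise
  where
    pointwise : ∀ X → (size X ≡ᵇ k) ∧ (components G X ≡ᵇ 1) ≡ (size X ≡ᵇ k)
    pointwise X with size X ≡ᵇ k in e
    ... | false = refl
    ... | true rewrite conn X (≡ᵇ-elim e) = refl

Qcoeff⇒allConnected : ∀ G k → Qcoeff G k 1 ≡ subsetsOfSize (n G) k → AllConnected G k
Qcoeff⇒allConnected G k e X size-X =
  ≡ᵇ-elim (countᵇ-∧-≡ (λ X → size X ≡ᵇ k) (λ X → components G X ≡ᵇ 1) (allSubsets (n G)) e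
             X (allSubsets-complete (n G) X) (≡ᵇ-intro size-X))

allConnected-transfer : ∀ {G H} → SameQ H G → n H ≡ n G → ∀ k → AllConnected G k → AllConnected H k
allConnected-transfer {G} {H} same order k conn = Qcoeff⇒allConnected H k (begin
  Qcoeff H k 1                ≡⟨ same k 1 ⟩
  Qcoeff G k 1                ≡⟨ allConnected⇒Qcoeff G k conn ⟩
  subsetsOfSize (n G) k       ≡⟨ cong (λ N → subsetsOfSize N k) (sym order) ⟩
  subsetsOfSize (n H) k       ∎)
  where open ≡-Reasoning

-- Edges and degrees, for an arbitrary symmetric irreflexive relation A
-- on Fin n (so that the handshake lemma can recurse on n).

Symmetric : ∀ n → (Fin n → Fin n → Bool) → Set
Symmetric n A = ∀ i j → A i j ≡ A j i

Irreflexive : ∀ n → (Fin n → Fin n → Bool) → Set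
Irreflexive n A = ∀ i → A i i ≡ false

adj⇒≢ : ∀ {n} (A : Fin n → Fin n → Bool) → Irreflexive n A → ∀ {i j} → A i j ≡ true → i ≢ j
adj⇒≢ A irr {i} e refl with trans (sym (irr i)) e
... | ()

hasEdge : ∀ n → (Fin n → Fin n → Bool) → (Fin n → Bool) → Bool
hasEdge n A x = anyᶠ n (λ u → x u ∧ anyᶠ n (λ w → x w ∧ A u w))

-- The number of edges, counted as the 2-subsets that span an edge.
edgeCount : ∀ n → (Fin n → Fin n → Bool) → ℕ
edgeCount n A = countᵇ (λ X → (count n (lookup X) ≡ᵇ 2) ∧ hasEdge n A (lookup X)) (allSubsets n)

degreeSum : ∀ n → (Fin n → Fin n → Bool) → ℕ
degreeSum n A = sumᶠ n (λ u → count n (A u))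

sumᶠ-ext : ∀ n (f g : Fin n → ℕ) → (∀ i → f i ≡ g i) → sumᶠ n f ≡ sumᶠ n g
sumᶠ-ext zero f g h = refl
sumᶠ-ext (suc n) f g h = cong₂ _+_ (h zero) (sumᶠ-ext n _ _ (h ∘ suc))

sumᶠ-+ : ∀ n (f g : Fin n → ℕ) → sumᶠ n (λ i → f i + g i) ≡ sumᶠ n f + sumᶠ n g
sumᶠ-+ zero f g = refl
sumᶠ-+ (suc n) f g =
  trans (cong (f zero + g zero +_) (sumᶠ-+ n (f ∘ suc) (g ∘ suc)))
        (interchange (f zero) (g zero) (sumᶠ n (f ∘ suc)) (sumᶠ n (g ∘ suc)))

sumᶠ-b2n : ∀ n (p : Fin n → Bool) → sumᶠ n (b2n ∘ p) ≡ count n p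
sumᶠ-b2n zero p = refl
sumᶠ-b2n (suc n) p = cong (b2n (p zero) +_) (sumᶠ-b2n n (p ∘ suc))

-- Exactly one subset is empty (the factor b lets this be used under a guard).
one-empty-subset : ∀ n (b : Bool) →
  countᵇ (λ X → (count n (lookup X) ≡ᵇ 0) ∧ b) (allSubsets n) ≡ b2n b
one-empty-subset zero true = refl
one-empty-subset zero false = refl
one-empty-subset (suc n) b =
  trans (countᵇ-allSubsets-suc n _)
        (cong₂ _+_ (countᵇ-none _ (allSubsets n) (λ _ → refl)) (one-empty-subset n b))

singletons : ∀ n (f : Fin n → Bool) →
  countᵇ (λ X → (count n (lookup X) ≡ᵇ 1) ∧ anyᶠ n (λ w → lookup X w ∧ f w)) (allSubsets n)
    ≡ count n f
singletons zero f = refl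
singletons (suc n) f =
  trans (countᵇ-allSubsets-suc n _)
        (cong₂ _+_ (trans (countᵇ-ext _ _ (allSubsets n) with-zero) (one-empty-subset n (f zero)))
                   (singletons n (f ∘ suc)))
  where
    with-zero : ∀ X → (count n (lookup X) ≡ᵇ 0) ∧ (f zero ∨ anyᶠ n (λ w → lookup X w ∧ f (suc w)))
                    ≡ (count n (lookup X) ≡ᵇ 0) ∧ f zero
    with-zero X with count n (lookup X) in e
    ... | zero rewrite anyᶠ-none n (λ w → lookup X w ∧ f (suc w))
                         (λ i → cong (_∧ f (suc i)) (count-zero n (lookup X) e i)) = ∨-identityʳ (f zero)
    ... | suc _ = refl

-- Both sides
-- are split according to vertex 0: the 2-subsets containing 0 that span an
-- edge are the singletons {w} adjacent to 0, counted by the degree d₀ of 0,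
-- and vertex 0 contributes d₀ to the degree sum both directly and through
-- its neighbours.
handshake : ∀ n (A : Fin n → Fin n → Bool) → Symmetric n A → Irreflexive n A →
  2 * edgeCount n A ≡ degreeSum n A
handshake zero A sym-A irr = refl
handshake (suc n) A sym-A irr = begin
  2 * edgeCount (suc n) A              ≡⟨ cong (2 *_) edges-split ⟩
  2 * (d₀ + edgeCount n A')            ≡⟨ arith d₀ (edgeCount n A') ⟩
  d₀ + (d₀ + 2 * edgeCount n A')       ≡⟨ cong (λ z → d₀ + (d₀ + z)) (handshake n A' (λ i j → sym-A (suc i) (suc j)) (irr ∘ suc)) ⟩
  d₀ + (d₀ + degreeSum n A')           ≡⟨ sym degrees-split ⟩
  degreeSum (suc n) A                  ∎
  where
    open ≡-Reasoning
    A' : Fin n → Fin n → Bool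
    A' i j = A (suc i) (suc j)
    d₀ : ℕ
    d₀ = count n (λ i → A zero (suc i))
    arith : ∀ d e → 2 * (d + e) ≡ d + (d + 2 * e)
    arith = solve-∀
    with-zero : ∀ X → (suc (count n (lookup X)) ≡ᵇ 2) ∧ hasEdge (suc n) A (lookup (true ∷ X))
                    ≡ (count n (lookup X) ≡ᵇ 1) ∧ anyᶠ n (λ w → lookup X w ∧ A zero (suc w))
    with-zero X with count n (lookup X) in e
    ... | zero = refl
    ... | suc (suc _) = refl
    ... | suc zero rewrite irr zero = ∨-absorbʳ _ _ edge-elsewhere
      where
        edge-elsewhere : _ ≡ true → anyᶠ n (λ w → lookup X w ∧ A zero (suc w)) ≡ true
        edge-elsewhere r with anyᶠ-elim n _ r
        ... | u , eu with ∨-elim {A (suc u) zero} (∧-elimʳ {lookup X u} eu)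
        ...   | inj₁ a = anyᶠ-intro n _ u (subst (λ z → z ∧ A zero (suc u) ≡ true) (sym (∧-elimˡ eu))
                                             (trans (sym-A zero (suc u)) a))
        ...   | inj₂ b with anyᶠ-elim n _ b
        ...     | w , ew with subst (2 ≤_) e (count≥2 n (lookup X) u w (∧-elimˡ eu) (∧-elimˡ ew)
                                (λ u≡w → adj⇒≢ A irr (∧-elimʳ {lookup X w} ew) (cong suc u≡w)))
        ...       | s≤s ()
    edges-split : edgeCount (suc n) A ≡ d₀ + edgeCount n A'
    edges-split =
      trans (countᵇ-allSubsets-suc n _)
            (cong (_+ edgeCount n A')
                  (trans (countᵇ-ext _ _ (allSubsets n) with-zero) (singletons n (λ i → A zero (suc i)))))
    degrees-split : degreeSum (suc n) A ≡ d₀ + (d₀ + degreeSum n A')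
    degrees-split rewrite irr zero = cong (d₀ +_) (begin
      sumᶠ n (λ u → b2n (A (suc u) zero) + count n (A' u))  ≡⟨ sumᶠ-+ n _ _ ⟩
      sumᶠ n (λ u → b2n (A (suc u) zero)) + degreeSum n A'  ≡⟨ cong (_+ degreeSum n A') column-zero ⟩
      d₀ + degreeSum n A'                                   ∎)
      where
        column-zero : sumᶠ n (λ u → b2n (A (suc u) zero)) ≡ d₀
        column-zero = trans (sumᶠ-b2n n _) (count-ext n _ _ (λ i → sym-A (suc i) zero))

module Pairs (G : Graph) (X : Subset (n G)) where
  private
    N : ℕ
    N = n G
    A : Fin N → Fin N → Bool
    A = adj G
    x : Fin N → Bool
    x = lookup X
  open Walks G X

  -- {r, o} with r < o and r ~ o: r is least and reaches o in one step.
  edge⇒connected : ∀ r o → toℕ r < toℕ o → x r ≡ true → x o ≡ true → A r o ≡ true →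
    (∀ c → x c ≡ true → c ≡ r ⊎ c ≡ o) → components G X ≡ 1
  edge⇒connected r o r<o xr xo aro only = one-component r xr least reach
    where
      least : ∀ u → x u ≡ true → toℕ r ≤ toℕ u
      least u xu with only u xu
      ... | inj₁ refl = ≤-refl
      ... | inj₂ refl = <⇒≤ r<o
      reach : ∀ u → x u ≡ true → u ≢ r → connected G X r u ≡ true
      reach u xu u≢r with only u xu
      ... | inj₁ u≡r = ⊥-elim (u≢r u≡r)
      ... | inj₂ refl = walk⇒connected 1 r o (≤-trans (s≤s z≤n) (≤-trans r<o (<⇒≤ (toℕ<n o))))
                          (walk-step 0 r r o (walk-refl 0 r xr) aro xo)

  -- {a, b} without an edge: {a} is closed in G[X].
  nonedge⇒split : ∀ a b → a ≢ b → x a ≡ true → x b ≡ true → A a b ≡ false →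
    (∀ c → x c ≡ true → c ≡ a ⊎ c ≡ b) → 2 ≤ components G X
  nonedge⇒split a b a≢b xa xb ab only =
    two-components (_== a) isA-closed a b xa (==-refl a) xb (==-≢ (a≢b ∘ sym))
    where
      no-edge : ∀ {u v} → u ≡ a → v ≡ b → A u v ≡ true → ⊥
      no-edge refl refl e with trans (sym ab) e
      ... | ()
      isA-closed : Closed (_== a)
      isA-closed u v _ xv auv pu with ==-elim {a = u} pu
      ... | refl with only v xv
      ...   | inj₁ refl = ==-refl v
      ...   | inj₂ v≡b = ⊥-elim (no-edge refl v≡b auv)

  pair-hasEdge : ∀ a b → x a ≡ true → x b ≡ true → (∀ c → x c ≡ true → c ≡ a ⊎ c ≡ b) →
    hasEdge N A x ≡ A a b
  pair-hasEdge a b xa xb only = bool-ext to from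
    where
      to : hasEdge N A x ≡ true → A a b ≡ true
      to e with anyᶠ-elim N _ e
      ... | u , eu with anyᶠ-elim N _ (∧-elimʳ {x u} eu)
      ...   | w , ew with only u (∧-elimˡ eu) | only w (∧-elimˡ ew) | ∧-elimʳ {x w} ew
      ...     | inj₁ refl | inj₁ refl | auw = ⊥-elim (adj⇒≢ A (irrefl G) auw refl)
      ...     | inj₁ refl | inj₂ refl | auw = auw
      ...     | inj₂ refl | inj₁ refl | auw = trans (adj-sym G a b) auw
      ...     | inj₂ refl | inj₂ refl | auw = ⊥-elim (adj⇒≢ A (irrefl G) auw refl)
      from : A a b ≡ true → hasEdge N A x ≡ true
      from e = anyᶠ-intro N _ a (subst (λ z → z ∧ anyᶠ N (λ w → x w ∧ A a w) ≡ true) (sym xa)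
                 (anyᶠ-intro N _ b (subst (λ z → z ∧ A a b ≡ true) (sym xb) e)))

  pair-connected⇔edge : count N x ≡ 2 → (components G X ≡ᵇ 1) ≡ hasEdge N A x
  pair-connected⇔edge two with two-witnesses N x two
  ... | a , b , a≢b , xa , xb , only rewrite pair-hasEdge a b xa xb only with A a b in eab
  ... | true with <-cmp (toℕ a) (toℕ b)
  ...   | tri< a<b _ _ = cong (_≡ᵇ 1) (edge⇒connected a b a<b xa xb eab only)
  ...   | tri≈ _ a≡b _ = ⊥-elim (a≢b (toℕ-injective a≡b))
  ...   | tri> _ _ b<a = cong (_≡ᵇ 1) (edge⇒connected b a b<a xb xa (trans (adj-sym G b a) eab)
                                          (λ c xc → swap (only c xc)))
    where swap : ∀ {P Q : Set} → P ⊎ Q → Q ⊎ P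
          swap (inj₁ p) = inj₂ p
          swap (inj₂ q) = inj₁ q
  pair-connected⇔edge two | a , b , a≢b , xa , xb , only | false
    with components G X | nonedge⇒split a b a≢b xa xb eab only
  ... | suc (suc _) | _ = refl
  ... | suc zero | s≤s ()

Qcoeff-edges : ∀ G → Qcoeff G 2 1 ≡ edgeCount (n G) (adj G)
Qcoeff-edges G = countᵇ-ext _ _ (allSubsets (n G)) pointwise
  where
    pointwise : ∀ X → (size X ≡ᵇ 2) ∧ (components G X ≡ᵇ 1)
                    ≡ (count (n G) (lookup X) ≡ᵇ 2) ∧ hasEdge (n G) (adj G) (lookup X)
    pointwise X rewrite size≡count X with count (n G) (lookup X) in e
    ... | zero = refl
    ... | suc zero = refl
    ... | suc (suc zero) = Pairs.pair-connected⇔edge G X e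
    ... | suc (suc (suc _)) = refl

degree : (G : Graph) → Fin (n G) → ℕ
degree G v = count (n G) (adj G v)

degreeSum-Qcoeff : ∀ G → sumᶠ (n G) (degree G) ≡ 2 * Qcoeff G 2 1
degreeSum-Qcoeff G = sym (trans (cong (2 *_) (Qcoeff-edges G)) (handshake (n G) (adj G) (adj-sym G) (irrefl G)))

-- G is connected: a vertex predicate closed under adjacency that holds
-- somewhere holds everywhere.
Connected : Graph → Set
Connected G = ∀ (P : Fin (n G) → Bool) → (∀ x y → adj G x y ≡ true → P x ≡ true → P y ≡ true) →
  ∀ u w → P u ≡ true → P w ≡ true

-- If the whole vertex set induces one component, G is connected: a closed
-- P holding at u but not at w would split it.
allConnected⇒connected : ∀ G → AllConnected G (n G) → Connected G
allConnected⇒connected G conn P closed u w pu with P w in pw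
... | true = refl
... | false with subst (2 ≤_) (conn (full (n G)) (size-full (n G)))
                  (two-components P (λ x y _ _ → closed x y) u w
                     (lookup-full (n G) u) pu (lookup-full (n G) w) pw)
  where open Walks G (full (n G))
... | s≤s ()

without : ∀ {N} → Fin N → Subset N
without u = tabulateⱽ (λ w → not (w == u))

lookup-without : ∀ {N} (u w : Fin N) → lookup (without u) w ≡ not (w == u)
lookup-without u w = lookup∘tabulate (λ w → not (w == u)) w

size-without : ∀ {N} (u : Fin N) → size (without u) ≡ N ∸ 1
size-without {N} u = begin
  size (without u)                    ≡⟨ size≡count (without u) ⟩
  count N (lookup (without u))        ≡⟨ count-ext N _ _ (lookup-without u) ⟩
  count N (not ∘ (_== u))             ≡⟨ sym (m+n∸m≡n 1 _) ⟩
  1 + count N (not ∘ (_== u)) ∸ 1     ≡⟨ cong (λ k → k + count N (not ∘ (_== u)) ∸ 1) (sym just-u) ⟩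
  count N (_== u) + count N (not ∘ (_== u)) ∸ 1 ≡⟨ cong (_∸ 1) (count-complement N (_== u)) ⟩
  N ∸ 1                               ∎
  where
    open ≡-Reasoning
    just-u : count N (_== u) ≡ 1
    just-u = count-unique N (_== u) u (==-refl u) (λ z → ==-≢)

third-vertex : ∀ {N} → 3 ≤ N → (u v : Fin N) → Σ (Fin N) λ z → z ≢ u × z ≢ v
third-vertex {suc (suc (suc _))} (s≤s (s≤s (s≤s _))) u v with zero ≟ u | zero ≟ v
... | no 0≢u | no 0≢v = zero , 0≢u , 0≢v
... | yes refl | _ with suc zero ≟ v
...   | no 1≢v = suc zero , (λ ()) , 1≢v
...   | yes refl = suc (suc zero) , (λ ()) , (λ ())
third-vertex _ u v | no _ | yes refl with suc zero ≟ u
...   | no 1≢u = suc zero , 1≢u , (λ ())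
...   | yes refl = suc (suc zero) , (λ ()) , (λ ())

low-degree-neighbour : ∀ G → 3 ≤ n G → ∀ v → degree G v ≤ 1 →
  Σ (Fin (n G)) λ u → u ≢ v × (∀ w → adj G v w ≡ true → w ≡ u)
low-degree-neighbour G three v deg≤1 with degree G v in e | deg≤1
... | zero | _ with third-vertex three v v
...   | u , u≢v , _ = u , u≢v , λ w avw → ⊥-elim (false≢true (trans (sym (count-zero (n G) (adj G v) e w)) avw))
  where false≢true : false ≡ true → ⊥
        false≢true ()
low-degree-neighbour G three v deg≤1 | suc zero | _ with count≡1-elim (n G) (adj G v) e
... | u , avu , only = u , (λ u≡v → adj⇒≢ (adj G) (irrefl G) avu (sym u≡v)) , only
low-degree-neighbour G three v deg≤1 | suc (suc _) | s≤s ()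

-- If deleting any single vertex leaves a connected graph (and n ≥ 3),
-- every vertex has degree ≥ 2: if the neighbours of v lie in {u}, deleting
-- u isolates v from a third vertex.
min-degree-two : ∀ G → 3 ≤ n G → AllConnected G (n G ∸ 1) → ∀ v → 2 ≤ degree G v
min-degree-two G three conn v with 2 ≤? degree G v
... | yes deg≥2 = deg≥2
... | no deg≱2 with low-degree-neighbour G three v (≤-pred (≰⇒> deg≱2))
...   | u , u≢v , only with third-vertex three u v
...     | z , z≢u , z≢v with subst (2 ≤_) (conn (without u) (size-without u))
          (two-components (_== v) isV-closed v z (in-X v (u≢v ∘ sym)) (==-refl v) (in-X z z≢u) (==-≢ z≢v))
  where
    open Walks G (without u)
    in-X : ∀ w → w ≢ u → lookup (without u) w ≡ true
    in-X w w≢u = trans (lookup-without u w) (cong not (==-≢ w≢u))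
    not-in-X : ∀ w → w ≡ u → lookup (without u) w ≡ true → ⊥
    not-in-X w refl xw with trans (sym xw) (trans (lookup-without w w) (cong not (==-refl w)))
    ... | ()
    isV-closed : Closed (_== v)
    isV-closed x y _ xy axy px with ==-elim {a = x} px
    ... | refl = ⊥-elim (not-in-X y (only y axy) xy)
...       | s≤s ()

all-two : ∀ n (f : Fin n → ℕ) → sumᶠ n f ≡ 2 * n → (∀ i → 2 ≤ f i) → ∀ i → f i ≡ 2
all-two (suc n) f sum≡ ≥2 = pointwise
  where
    lower : ∀ k (g : Fin k → ℕ) → (∀ i → 2 ≤ g i) → 2 * k ≤ sumᶠ k g
    lower zero g h = z≤n
    lower (suc k) g h = subst (_≤ sumᶠ (suc k) g) (sym (*-suc 2 k)) (+-mono-≤ (h zero) (lower k (g ∘ suc) (h ∘ suc)))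
    sum≡' : f zero + sumᶠ n (f ∘ suc) ≡ 2 + 2 * n
    sum≡' = trans sum≡ (*-suc 2 n)
    f0≡2 : f zero ≡ 2
    f0≡2 = ≤-antisym (+-cancelʳ-≤ (2 * n) (f zero) 2
                        (≤-trans (+-monoʳ-≤ (f zero) (lower n (f ∘ suc) (≥2 ∘ suc))) (≤-reflexive sum≡')))
                     (≥2 zero)
    rest : sumᶠ n (f ∘ suc) ≡ 2 * n
    rest = +-cancelˡ-≡ 2 _ _ (trans (cong (_+ sumᶠ n (f ∘ suc)) (sym f0≡2)) sum≡')
    pointwise : ∀ i → f i ≡ 2
    pointwise zero = f0≡2
    pointwise (suc i) = all-two n (f ∘ suc) rest (≥2 ∘ suc) i

module CycleFacts (m' : ℕ) (three : 3 ≤ suc m') where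
  m : ℕ
  m = suc m'
  C : Graph
  C = Cycle m three

  vx : ℕ → Fin m
  vx x = x mod m

  toℕ-vx : ∀ x → x < m → toℕ (vx x) ≡ x
  toℕ-vx x lt = trans (toℕ-fromℕ< _) (m<n⇒m%n≡m lt)

  vx-toℕ : ∀ (u : Fin m) → vx (toℕ u) ≡ u
  vx-toℕ u = toℕ-injective (toℕ-vx (toℕ u) (toℕ<n u))

  vx-m : vx m ≡ zero
  vx-m = toℕ-injective (trans (toℕ-fromℕ< _) (n%n≡0 m))

  suc-mod : ∀ (i : Fin m) →
    (suc (toℕ i) < m × suc (toℕ i) % m ≡ suc (toℕ i)) ⊎ (suc (toℕ i) ≡ m × suc (toℕ i) % m ≡ 0)
  suc-mod i with m≤n⇒m<n∨m≡n (toℕ<n i)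
  ... | inj₁ lt = inj₁ (lt , m<n⇒m%n≡m lt)
  ... | inj₂ eq = inj₂ (eq , trans (cong (_% m) eq) (n%n≡0 m))

  next : Fin m → Fin m
  next i = vx (suc (toℕ i))

  prev : Fin m → Fin m
  prev zero = fromℕ m'
  prev (suc j) = inject₁ j

  next-prev : ∀ i → suc (toℕ (prev i)) % m ≡ toℕ i
  next-prev zero = trans (cong (λ z → suc z % m) (toℕ-fromℕ m')) (n%n≡0 m)
  next-prev (suc j) = trans (cong (λ z → suc z % m) (toℕ-inject₁ j)) (m<n⇒m%n≡m (s≤s (toℕ<n j)))

  adj-next : ∀ i → cycAdj m i (next i) ≡ true
  adj-next i = ∨-introˡ _ (≡ᵇ-intro {suc (toℕ i) % m} (sym (toℕ-fromℕ< _)))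

  adj-prev : ∀ i → cycAdj m i (prev i) ≡ true
  adj-prev i = ∨-introʳ (suc (toℕ i) % m ≡ᵇ toℕ (prev i)) (≡ᵇ-intro (next-prev i))

  adj-succ : ∀ (x y : Fin m) → toℕ y ≡ suc (toℕ x) → cycAdj m x y ≡ true
  adj-succ x y e with suc-mod x
  ... | inj₁ (_ , q) = ∨-introˡ _ (≡ᵇ-intro (trans q (sym e)))
  ... | inj₂ (q , _) = ⊥-elim (<-irrefl (trans e q) (toℕ<n y))

  neighbours : ∀ i z → cycAdj m i z ≡ true → z ≡ next i ⊎ z ≡ prev i
  neighbours i z e with ∨-elim {suc (toℕ i) % m ≡ᵇ toℕ z} e
  ... | inj₁ e₁ = inj₁ (toℕ-injective (trans (sym (≡ᵇ-elim e₁)) (sym (toℕ-fromℕ< _))))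
  ... | inj₂ e₂ = inj₂ (toℕ-injective (is-prev i (≡ᵇ-elim e₂)))
    where
      is-prev : ∀ i → suc (toℕ z) % m ≡ toℕ i → toℕ z ≡ toℕ (prev i)
      is-prev zero q with suc-mod z
      ... | inj₁ (_ , r) with trans (sym r) q
      ...   | ()
      is-prev zero q | inj₂ (r , _) = trans (suc-injective r) (sym (toℕ-fromℕ m'))
      is-prev (suc j) q with suc-mod z
      ... | inj₁ (_ , r) = trans (suc-injective (trans (sym r) q)) (sym (toℕ-inject₁ j))
      ... | inj₂ (_ , r) with trans (sym r) q
      ...   | ()

  -- Since m ≥ 3, the two neighbours are distinct.
  next≢prev : ∀ i → next i ≢ prev i
  next≢prev i e with cong toℕ e | suc-mod i
  next≢prev zero e | q | inj₁ (_ , r) = <⇒≱ (s≤s⁻¹ three) (≤-reflexive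
    (trans (sym (toℕ-fromℕ m')) (trans (sym q) (trans (toℕ-fromℕ< _) r))))
  next≢prev (suc j) e | q | inj₁ (_ , r) = <-irrefl (sym q′) (n≤1+n _)
    where
      q′ : suc (suc (toℕ j)) ≡ toℕ j
      q′ = trans (sym (trans (toℕ-fromℕ< _) r)) (trans q (toℕ-inject₁ j))
  next≢prev zero e | q | inj₂ (r , _) = <⇒≱ (≤-trans (s≤s (s≤s z≤n)) three) (≤-reflexive (sym r))
  next≢prev (suc j) e | q | inj₂ (r , r′) = <⇒≱ three (≤-reflexive (sym (subst (λ k → suc (suc k) ≡ m) j≡0 r)))
    where
      j≡0 : toℕ j ≡ 0
      j≡0 = trans (sym (toℕ-inject₁ j)) (trans (sym q) (trans (toℕ-fromℕ< _) r′))

  degree-two : ∀ i → degree C i ≡ 2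
  degree-two i = count-pair m (cycAdj m i) (next i) (prev i) (adj-next i) (adj-prev i) (next≢prev i) (neighbours i)

  degreeSum-cycle : sumᶠ m (degree C) ≡ 2 * m
  degreeSum-cycle = trans (sumᶠ-ext m _ _ degree-two) (constant m)
    where
      constant : ∀ k → sumᶠ k (λ _ → 2) ≡ 2 * k
      constant zero = refl
      constant (suc k) = trans (cong (2 +_) (constant k)) (sym (*-suc 2 k))

  forward-arc : (X : Subset m) (a b : ℕ) → b < m → (∀ t → a ≤ t → t ≤ b → lookup X (vx t) ≡ true) →
    ∀ u → a ≤ toℕ u → toℕ u ≤ b → connected C X (vx a) u ≡ true
  forward-arc X a b b<m inX u a≤u u≤b =
    walk⇒connected d (vx a) u (≤-trans (m∸n≤m (toℕ u) a) (<⇒≤ (toℕ<n u)))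
      (subst₂ (λ s t → walk C X d s t ≡ true) (cong vx (+-identityʳ a)) reaches-u
        (path-walk (λ k → vx (a + k)) (b ∸ a) on-arc step d (∸-monoˡ-≤ a u≤b)))
    where
      open Walks C X
      d : ℕ
      d = toℕ u ∸ a
      reaches-u : vx (a + d) ≡ u
      reaches-u = trans (cong vx (m+[n∸m]≡n a≤u)) (vx-toℕ u)
      a+k≤b : ∀ k → k ≤ b ∸ a → a + k ≤ b
      a+k≤b k k≤ = ≤-trans (+-monoʳ-≤ a k≤) (≤-reflexive (m+[n∸m]≡n (≤-trans a≤u u≤b)))
      on-arc : ∀ k → k ≤ b ∸ a → lookup X (vx (a + k)) ≡ true
      on-arc k k≤ = inX (a + k) (m≤m+n a k) (a+k≤b k k≤)
      step : ∀ k → k < b ∸ a → cycAdj m (vx (a + k)) (vx (a + suc k)) ≡ true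
      step k k< = adj-succ _ _ (begin
        toℕ (vx (a + suc k))   ≡⟨ toℕ-vx (a + suc k) (≤-<-trans (a+k≤b (suc k) k<) b<m) ⟩
        a + suc k              ≡⟨ +-suc a k ⟩
        suc (a + k)            ≡⟨ cong suc (sym (toℕ-vx (a + k) (≤-<-trans (a+k≤b k (<⇒≤ k<)) b<m))) ⟩
        suc (toℕ (vx (a + k))) ∎)
        where open ≡-Reasoning

  backward-arc : (X : Subset m) (c : ℕ) → c ≤ m → lookup X zero ≡ true →
    (∀ t → c ≤ t → t < m → lookup X (vx t) ≡ true) →
    ∀ u → c ≤ toℕ u → connected C X zero u ≡ true
  backward-arc X c c≤m x0 inX u c≤u =
    walk⇒connected d zero u (m∸n≤m m (toℕ u))
      (subst₂ (λ s t → walk C X d s t ≡ true) vx-m reaches-u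
        (path-walk (λ k → vx (m ∸ k)) (m ∸ c) on-arc step d (∸-monoʳ-≤ m c≤u)))
    where
      open Walks C X
      d : ℕ
      d = m ∸ toℕ u
      reaches-u : vx (m ∸ d) ≡ u
      reaches-u = trans (cong vx (m∸[m∸n]≡n (<⇒≤ (toℕ<n u)))) (vx-toℕ u)
      on-arc : ∀ k → k ≤ m ∸ c → lookup X (vx (m ∸ k)) ≡ true
      on-arc zero _ = subst (λ z → lookup X z ≡ true) (sym vx-m) x0
      on-arc (suc k) k< = inX (m ∸ suc k)
        (≤-trans (≤-reflexive (sym (m∸[m∸n]≡n c≤m))) (∸-monoʳ-≤ m k<)) (s≤s (m∸n≤m m' k))
      step : ∀ k → k < m ∸ c → cycAdj m (vx (m ∸ k)) (vx (m ∸ suc k)) ≡ true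
      step k k< = ∨-introʳ _ (≡ᵇ-intro (begin
        suc (toℕ (vx (m ∸ suc k))) % m ≡⟨ cong (λ z → suc z % m) (toℕ-vx (m ∸ suc k) (s≤s (m∸n≤m m' k))) ⟩
        suc (m ∸ suc k) % m            ≡⟨ cong (_% m) (suc-∸ k (<-≤-trans k< (m∸n≤m m c))) ⟩
        (m ∸ k) % m                    ≡⟨ sym (toℕ-fromℕ< _) ⟩
        toℕ (vx (m ∸ k))               ∎))
        where
          open ≡-Reasoning
          suc-∸ : ∀ k → k < m → suc (m ∸ suc k) ≡ m ∸ k
          suc-∸ k k<m = trans (sym (+-∸-assoc 1 k<m)) refl

  cycle-connected : AllConnected C m
  cycle-connected X size-X = one-component zero (all-in zero) (λ _ _ → z≤n) reach
    where
      open Walks C X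
      all-in : ∀ i → lookup X i ≡ true
      all-in = size-n⇒full X size-X
      reach : ∀ u → lookup X u ≡ true → u ≢ zero → connected C X zero u ≡ true
      reach u _ _ = forward-arc X 0 m' ≤-refl (λ t _ _ → all-in (vx t)) u z≤n (s≤s⁻¹ (toℕ<n u))

  -- Removing one vertex v from the cycle leaves a path, which is connected:
  -- for v = 0 walk forwards from 1; otherwise walk from 0 forwards to the
  -- vertices below v and backwards to those above v.
  cycle-minus-vertex : ∀ (X : Subset m) v → (∀ w → w ≢ v → lookup X w ≡ true) → lookup X v ≡ false →
    components C X ≡ 1
  cycle-minus-vertex X zero in-X x0 = one-component (vx 1) (in-X (vx 1) 1≢0) least reach
    where
      open Walks C X
      toℕ-1 : toℕ (vx 1) ≡ 1
      toℕ-1 = toℕ-vx 1 (≤-trans (s≤s (s≤s z≤n)) three)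
      1≢0 : vx 1 ≢ zero
      1≢0 e with trans (sym toℕ-1) (cong toℕ e)
      ... | ()
      positive : ∀ u → lookup X u ≡ true → 1 ≤ toℕ u
      positive zero xu with trans (sym xu) x0
      ... | ()
      positive (suc u) xu = s≤s z≤n
      least : ∀ u → lookup X u ≡ true → toℕ (vx 1) ≤ toℕ u
      least u xu = subst (_≤ toℕ u) (sym toℕ-1) (positive u xu)
      reach : ∀ u → lookup X u ≡ true → u ≢ vx 1 → connected C X (vx 1) u ≡ true
      reach u xu _ = forward-arc X 1 m' ≤-refl
        (λ t 1≤t t≤m' → in-X (vx t) (λ e → <-irrefl (trans (sym (cong toℕ e)) (toℕ-vx t (s≤s t≤m'))) 1≤t))
        u (positive u xu) (s≤s⁻¹ (toℕ<n u))
  cycle-minus-vertex X v@(suc j) in-X xv = one-component zero x0 (λ _ _ → z≤n) reach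
    where
      open Walks C X
      x0 : lookup X zero ≡ true
      x0 = in-X zero (λ ())
      in-X′ : ∀ t → t < m → t ≢ toℕ v → lookup X (vx t) ≡ true
      in-X′ t t<m t≢v = in-X (vx t) (λ e → t≢v (trans (sym (toℕ-vx t t<m)) (cong toℕ e)))
      reach : ∀ u → lookup X u ≡ true → u ≢ zero → connected C X zero u ≡ true
      reach u xu _ with <-cmp (toℕ u) (toℕ v)
      ... | tri< u<v _ _ = forward-arc X 0 (toℕ j) j<m
              (λ t _ t≤j → in-X′ t (≤-<-trans t≤j j<m) (<⇒≢ (s≤s t≤j)))
              u z≤n (s≤s⁻¹ u<v)
        where
          j<m : toℕ j < m
          j<m = ≤-trans (toℕ<n j) (n≤1+n m')
      ... | tri≈ _ u≡v _ with trans (sym xu) (trans (cong (lookup X) (toℕ-injective u≡v)) xv)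
      ...   | ()
      reach u xu _ | tri> _ _ v<u = backward-arc X (suc (toℕ v)) (toℕ<n v) x0
              (λ t v<t t<m → in-X′ t t<m (<⇒≢ v<t ∘ sym)) u v<u

  -- Every m'-element vertex set of the cycle misses one vertex, so is connected.
  cycle-minus-connected : AllConnected C m'
  cycle-minus-connected X size-X with size-pred⇒one-missing m' X size-X
  ... | v , xv , only-v = cycle-minus-vertex X v in-X xv
    where
      in-X : ∀ w → w ≢ v → lookup X w ≡ true
      in-X w w≢v with lookup X w in xw
      ... | true = refl
      ... | false = ⊥-elim (w≢v (only-v w xw))

-- Starting at vertex 0, walk v₀, v₁, v₂, … always
-- leaving a vertex by the edge not used to enter it.  The first repetition
-- must return to v₀ (a degree-2 vertex cannot be entered a third way), and
-- a return at time J makes {v₀, …, v_{J-1}} closed under adjacency, hence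
-- all of V by connectedness, so J = m.  Thus k ↦ v_k is a bijection
-- Fin m → V carrying the cycle's edges k ~ k ± 1 onto those of G.
module CycleRecognition (m' : ℕ) (three : 3 ≤ suc m') (A : Fin (suc m') → Fin (suc m') → Bool)
  (sym-A : ∀ i j → A i j ≡ A j i) (irr : ∀ i → A i i ≡ false) where
  open CycleFacts m' three

  G : Graph
  G = record { n = m ; adj = A ; sym = sym-A ; irrefl = irr }

  module _ (two-regular : ∀ u → degree G u ≡ 2) (G-connected : Connected G) where
    V : Set
    V = Fin m

    adj⇒≢′ : ∀ {x y} → A x y ≡ true → x ≢ y
    adj⇒≢′ = adj⇒≢ A irr

    only-two-neighbours : ∀ y a b c → A y a ≡ true → A y b ≡ true → A y c ≡ true → a ≢ b →
      c ≡ a ⊎ c ≡ b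
    only-two-neighbours y a b c ya yb yc a≢b with c ≟ a | c ≟ b
    ... | yes c≡a | _ = inj₁ c≡a
    ... | no _ | yes c≡b = inj₂ c≡b
    ... | no c≢a | no c≢b
      with subst (3 ≤_) (two-regular y) (count≥3 m (A y) a b c ya yb yc a≢b (c≢a ∘ sym) (c≢b ∘ sym))
    ...   | s≤s (s≤s ())

    -- The choices below are opaque: only their specifications matter, and
    -- unfolding them would make the trail computations below very slow.
    opaque
      other-neighbour : ∀ (x y : V) → Σ V λ z → A y z ≡ true × z ≢ x
      other-neighbour x y with two-witnesses m (A y) (two-regular y)
      ... | a , b , a≢b , ya , yb , _ with a ≟ x
      ...   | yes refl = b , yb , a≢b ∘ sym
      ...   | no a≢x = a , ya , a≢x

      neighbour-of-zero : Σ V λ z → A zero z ≡ true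
      neighbour-of-zero with two-witnesses m (A zero) (two-regular zero)
      ... | a , _ , _ , 0a , _ = a , 0a

    -- The trail: consecutive pairs (v k , v (k+1)), joined by an edge; each
    -- step continues along the edge not just traversed.
    Step : Set
    Step = Σ (V × V) λ p → A (proj₁ p) (proj₂ p) ≡ true

    continue : Step → Step
    continue ((x , y) , _) = (y , proj₁ (other-neighbour x y)) , proj₁ (proj₂ (other-neighbour x y))

    trail : ℕ → Step
    trail zero = (zero , proj₁ neighbour-of-zero) , proj₂ neighbour-of-zero
    trail (suc k) = continue (trail k)

    v : ℕ → V
    v k = proj₁ (proj₁ (trail k))

    v-adj : ∀ k → A (v k) (v (suc k)) ≡ true
    v-adj k = proj₂ (trail k)

    v-adj′ : ∀ k → A (v (suc k)) (v k) ≡ true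
    v-adj′ k = trans (sym-A _ _) (v-adj k)

    no-backtrack : ∀ k → v (suc (suc k)) ≢ v k
    no-backtrack k = proj₂ (proj₂ (other-neighbour (v k) (v (suc k))))

    Distinct : ℕ → Set
    Distinct J = ∀ i j → i < j → j < J → v i ≢ v j

    distinct′ : ∀ {J} → Distinct J → ∀ i j → i ≢ j → i < J → j < J → v i ≢ v j
    distinct′ dist i j i≢j i<J j<J with <-cmp i j
    ... | tri< lt _ _ = dist i j lt j<J
    ... | tri≈ _ eq _ = ⊥-elim (i≢j eq)
    ... | tri> _ _ gt = λ e → dist j i gt i<J (sym e)

    -- If v₀, …, v_{J-1} are distinct and v_J repeats v_i, then i = 0: for
    -- i > 0 the neighbour v_{J-1} of v_J = v_i would be neither v_{i-1} nor
    -- v_{i+1}, the only neighbours of v_i.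
    first-repeat : ∀ J → Distinct J → ∀ i → i < J → v i ≡ v J → i ≡ 0
    first-repeat J dist zero _ _ = refl
    first-repeat (suc J) dist (suc i) (s≤s i<J) e with <-cmp (suc (suc i)) J
    ... | tri≈ _ i+2≡J _ = ⊥-elim (no-backtrack (suc i) (trans (cong (v ∘ suc) i+2≡J) (sym e)))
    ... | tri> _ _ J<i+2 = ⊥-elim (adj⇒≢′ (v-adj (suc i)) (trans e (cong (v ∘ suc) J≡i+1)))
      where
        J≡i+1 : J ≡ suc i
        J≡i+1 = ≤-antisym (s≤s⁻¹ J<i+2) i<J
    ... | tri< i+2<J _ _
      with only-two-neighbours (v (suc i)) (v i) (v (suc (suc i))) (v J)
             (v-adj′ i) (v-adj (suc i)) (subst (λ z → A z (v J) ≡ true) (sym e) (v-adj′ J))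
             (no-backtrack i ∘ sym)
    ...   | inj₁ vJ≡vi = ⊥-elim (dist i J i<J (n<1+n J) (sym vJ≡vi))
    ...   | inj₂ vJ≡vi+2 = ⊥-elim (dist (suc (suc i)) J i+2<J (n<1+n J) (sym vJ≡vi+2))

    visited : ℕ → V → Bool
    visited J w = anyᶠ J (λ k → v (toℕ k) == w)

    visited-intro : ∀ J k → k < J → visited J (v k) ≡ true
    visited-intro J k k<J =
      anyᶠ-intro J _ (fromℕ< k<J) (subst (λ z → v z == v k ≡ true) (sym (toℕ-fromℕ< k<J)) (==-refl (v k)))

    -- A trail of distinct vertices that returns to v₀ at time J ≥ 1 has
    -- visited every vertex: each visited vertex has both its neighbours
    -- among the visited ones, so by connectedness everything is visited.
    closed-trail-covers : ∀ J → 0 < J → Distinct J → v J ≡ v 0 → ∀ w → Σ (Fin J) λ k → v (toℕ k) ≡ w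
    closed-trail-covers (suc zero) _ dist e w = ⊥-elim (adj⇒≢′ (v-adj 0) (sym e))
    closed-trail-covers (suc (suc zero)) _ dist e w = ⊥-elim (no-backtrack 0 e)
    closed-trail-covers J@(suc (suc (suc J″))) _ dist e w with covered
      where
        J′ : ℕ
        J′ = suc (suc J″)
        last-adj : A (v J′) (v 0) ≡ true
        last-adj = subst (λ z → A (v J′) z ≡ true) e (v-adj J′)
        trail-neighbours : ∀ k → k < J → Σ ℕ λ a → Σ ℕ λ b → a < J × b < J ×
          A (v k) (v a) ≡ true × A (v k) (v b) ≡ true × v a ≢ v b
        trail-neighbours zero _ = 1 , J′ , s≤s (s≤s z≤n) , n<1+n J′ , v-adj 0 , trans (sym-A _ _) last-adj ,
                                  dist 1 J′ (s≤s (s≤s z≤n)) (n<1+n J′)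
        trail-neighbours (suc k) k<J with <-cmp (suc k) J′
        ... | tri< k+1<J′ _ _ = k , suc (suc k) , ≤-trans (n≤1+n _) k<J , s≤s k+1<J′ ,
                                v-adj′ k , v-adj (suc k) , no-backtrack k ∘ sym
        ... | tri≈ _ k+1≡J′ _ = k , 0 , ≤-trans (n≤1+n _) k<J , s≤s z≤n , v-adj′ k ,
                                subst (λ z → A (v z) (v 0) ≡ true) (sym k+1≡J′) last-adj ,
                                λ e′ → dist 0 k (subst (0 <_) (sym (suc-injective k+1≡J′)) (s≤s z≤n))
                                              (≤-trans (n≤1+n _) k<J) (sym e′)
        ... | tri> _ _ J′<k+1 = ⊥-elim (<-irrefl refl (≤-trans k<J J′<k+1))
        visited-closed : ∀ x y → A x y ≡ true → visited J x ≡ true → visited J y ≡ true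
        visited-closed x y axy x-visited with anyᶠ-elim J _ x-visited
        ... | k , ek with ==-elim {a = v (toℕ k)} {b = x} ek
        ...   | refl with trail-neighbours (toℕ k) (toℕ<n k)
        ...     | a , b , a<J , b<J , ka , kb , a≢b with only-two-neighbours (v (toℕ k)) (v a) (v b) y ka kb axy a≢b
        ...       | inj₁ refl = visited-intro J a a<J
        ...       | inj₂ refl = visited-intro J b b<J
        covered : Σ (Fin J) λ k → (v (toℕ k) == w) ≡ true
        covered = anyᶠ-elim J _ (G-connected (visited J) visited-closed zero w (visited-intro J 0 (s≤s z≤n)))
    ... | k , vk = k , ==-elim vk

    no-early-return : ∀ J → 0 < J → Distinct J → v J ≡ v 0 → J < m → ⊥
    no-early-return J J>0 dist e J<m = <⇒≱ J<m (injective⇒≤ position-injective)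
      where
        position : V → Fin J
        position w = proj₁ (closed-trail-covers J J>0 dist e w)
        position-injective : ∀ {x y} → position x ≡ position y → x ≡ y
        position-injective {x} {y} eq =
          trans (sym (proj₂ (closed-trail-covers J J>0 dist e x)))
                (trans (cong (v ∘ toℕ) eq) (proj₂ (closed-trail-covers J J>0 dist e y)))

    distinct-upto : ∀ J → J ≤ m → Distinct J
    distinct-upto zero _ i j _ ()
    distinct-upto (suc J) J<m i j i<j (s≤s j≤J) with m≤n⇒m<n∨m≡n j≤J
    ... | inj₁ j<J = distinct-upto J (≤-trans (n≤1+n J) J<m) i j i<j j<J
    ... | inj₂ refl = λ e → no-early-return j (≤-trans (s≤s z≤n) i<j) dist-j
                              (trans (sym e) (cong v (first-repeat j dist-j i i<j e))) J<m
      where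
        dist-j : Distinct j
        dist-j = distinct-upto j (≤-trans (n≤1+n j) J<m)

    distinct-m : Distinct m
    distinct-m = distinct-upto m ≤-refl

    period : v m ≡ v 0
    period with pigeonhole (n<1+n m) (λ (k : Fin (suc m)) → v (toℕ k))
    ... | i , j , i<j , vi≡vj with m≤n⇒m<n∨m≡n (s≤s⁻¹ (toℕ<n j))
    ...   | inj₁ j<m = ⊥-elim (distinct-m (toℕ i) (toℕ j) i<j j<m vi≡vj)
    ...   | inj₂ j≡m = trans (sym (cong v j≡m))
              (trans (sym vi≡vj) (cong v (first-repeat m distinct-m (toℕ i) (<-≤-trans i<j (≤-reflexive j≡m))
                                             (trans vi≡vj (cong v j≡m)))))

    position : Fin m → V
    position k = v (toℕ k)

    position-injective : ∀ {a b} → position a ≡ position b → a ≡ b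
    position-injective {a} {b} e with toℕ a Data.Nat.≟ toℕ b
    ... | yes eq = toℕ-injective eq
    ... | no neq = ⊥-elim (distinct′ distinct-m (toℕ a) (toℕ b) neq (toℕ<n a) (toℕ<n b) e)

    index : V → Fin m
    index w = proj₁ (closed-trail-covers m (s≤s z≤n) distinct-m period w)

    position-index : ∀ w → position (index w) ≡ w
    position-index w = proj₂ (closed-trail-covers m (s≤s z≤n) distinct-m period w)

    index-position : ∀ k → index (position k) ≡ k
    index-position k = position-injective (position-index (position k))

    position-next : ∀ (i : Fin m) → position (next i) ≡ v (suc (toℕ i))
    position-next i with suc-mod i
    ... | inj₁ (_ , r) = cong v (trans (toℕ-fromℕ< _) r)
    ... | inj₂ (i+1≡m , r) = trans (cong v (trans (toℕ-fromℕ< _) r)) (trans (sym period) (cong v (sym i+1≡m)))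

    adj-position-next : ∀ i → A (position i) (position (next i)) ≡ true
    adj-position-next i = subst (λ z → A (position i) z ≡ true) (sym (position-next i)) (v-adj (toℕ i))

    adj-position-prev : ∀ i → A (position i) (position (prev i)) ≡ true
    adj-position-prev zero = subst (λ z → A (v 0) (v z) ≡ true) (sym (toℕ-fromℕ m'))
                               (trans (sym-A _ _) (subst (λ z → A (v m') z ≡ true) period (v-adj m')))
    adj-position-prev (suc j) = subst (λ z → A (v (suc (toℕ j))) (v z) ≡ true) (sym (toℕ-inject₁ j)) (v-adj′ (toℕ j))

    position-preserves-adj : ∀ i j → cycAdj m i j ≡ A (position i) (position j)
    position-preserves-adj i j = bool-ext to from
      where
        to : cycAdj m i j ≡ true → A (position i) (position j) ≡ true
        to c with neighbours i j c
        ... | inj₁ refl = adj-position-next i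
        ... | inj₂ refl = adj-position-prev i
        from : A (position i) (position j) ≡ true → cycAdj m i j ≡ true
        from a with only-two-neighbours (position i) (position (next i)) (position (prev i)) (position j)
                      (adj-position-next i) (adj-position-prev i) a (next≢prev i ∘ position-injective)
        ... | inj₁ e = subst (λ z → cycAdj m i z ≡ true) (sym (position-injective e)) (adj-next i)
        ... | inj₂ e = subst (λ z → cycAdj m i z ≡ true) (sym (position-injective e)) (adj-prev i)

    is-cycle : G ≅ Cycle m three
    is-cycle = mk↔ₛ′ index position index-position position-index ,
               λ u w → trans (position-preserves-adj (index u) (index w)) (cong₂ A (position-index u) (position-index w))

proposition4p2 : (m : ℕ) → (h : 3 ≤ m) → (H : Graph) →
    SameQ H (Cycle m h) → H ≅ Cycle m h
proposition4p2 zero () H same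
proposition4p2 (suc m') three H same = recognise H same (order-determined same)
  where
    open CycleFacts m' three
    -- Q determines that H has m vertices; matching H's fields against this
    -- makes H the graph G of CycleRecognition on Fin m.
    recognise : ∀ H → SameQ H C → n H ≡ m → H ≅ C
    recognise record { adj = A ; sym = sym-A ; irrefl = irr } same refl = is-cycle two-regular H-connected
      where
        open CycleRecognition m' three A sym-A irr
        -- Like C_m, H is connected ...
        H-connected : Connected G
        H-connected = allConnected⇒connected G (allConnected-transfer same refl m cycle-connected)
        -- ... and stays connected after deleting any vertex, so δ(H) ≥ 2.
        min-degree : ∀ v → 2 ≤ degree G v
        min-degree = min-degree-two G three (allConnected-transfer same refl m' cycle-minus-connected)
        -- H has as many edges as C_m, so its degrees sum to 2m.
        degree-sum : sumᶠ m (degree G) ≡ 2 * m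
        degree-sum = begin
          sumᶠ m (degree G)   ≡⟨ degreeSum-Qcoeff G ⟩
          2 * Qcoeff G 2 1    ≡⟨ cong (2 *_) (same 2 1) ⟩
          2 * Qcoeff C 2 1    ≡⟨ sym (degreeSum-Qcoeff C) ⟩
          sumᶠ m (degree C)   ≡⟨ degreeSum-cycle ⟩
          2 * m               ∎
          where open ≡-Reasoning
        two-regular : ∀ v → degree G v ≡ 2
        two-regular = all-two m (degree G) degree-sum min-degree
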